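{- Let $(\pi,[\![-]\!]_\pi)$ be a Kripke-sheaf model with Kripke sheaf $\pi:(D,R_D)\to(X,R_X)$, and let $(E,R_E)$ be an event model, where each event $e\in E$ has a closed precondition sentence $\mathrm{Pre}(e)$ with interpretation $[\![\mathrm{Pre}(e)]\!]_\pi\subseteq X$. Then the pullback update $(\pi_{X\otimes E},[\![-]\!]_{\pi_{X\otimes E}})$ of this model along $p_X:X\otimes E\to X$ is again a Kripke-sheaf model: $\pi_{X\otimes E}:(D_{X\otimes E},R_{D_{X\otimes E}})\to(X\otimes E,R_{X\otimes E})$ is a Kripke sheaf, and for each $n$-ary function symbol $f$ the updated interpretation $[\![f]\!]_{\pi_{X\otimes E}}$ is a monotone map over $X\otimes E$ from the $n$-fold fibered product of $D_{X\otimes E}$ over $X\otimes E$ to $D_{X\otimes E}$.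
   Context: Kripke frames are pairs $(X,R_X)$ with $R_X\subseteq X\times X$; a monotone map $f:(X,R_X)\to(Y,R_Y)$ is a function with $wR_Xv\Rightarrow f(w)R_Yf(v)$; a bounded morphism is a monotone map such that whenever $f(w)R_Yv'$ there is $v$ with $wR_Xv$ and $f(v)=v'$. A Kripke sheaf over $(X,R_X)$ is a bounded morphism $\pi:(D,R_D)\to(X,R_X)$ such that if $aR_Db$, $aR_Db'$ and $\pi(b)=\pi(b')$ then $b=b'$. For $n\in\mathbb N$, $D^n_X=\{(a_1,\dots,a_n)\in D^n\mid\pi(a_1)=\dots=\pi(a_n)\}$ (with $D^0_X=X$, $D^1_X=D$), with $\pi^n:D^n_X\to X$, $\bar a\mapsto\pi(a_i)$, and relation $\bar aR_{D^n_X}\bar b$ iff $a_iR_Db_i$ for all $i$ (the $n$-fold fibered product). A Kripke-sheaf model consists of a Kripke sheaf $\pi$ together with an interpretation assigning to each $n$-ary function symbol $f$ a monotone map $[\![f]\!]_\pi:D^n_X\to D$ over $X$ (i.e. $\pi\circ[\![f]\!]_\pi=\pi^n$), to each $n$-ary relation symbol $F$ a subset $[\![F]\!]_\pi\subseteq D^n_X$, and thereby interpretations of all terms and formulas-in-context. An event model is a Kripke frame $(E,R_E)$ with preconditions as stated. The product update is $X\otimes E=\{(w,e)\in X\times E\mid w\in[\![\mathrm{Pre}(e)]\!]_\pi\}$ with $(w_1,e_1)R_{X\otimes E}(w_2,e_2)$ iff $w_1R_Xw_2$ and $e_1R_Ee_2$, and $p_X(w,e)=w$. The pullback update pulls the model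 back along $p_X$ in the category of Kripke frames and monotone maps: $D_{X\otimes E}=\{(a,e)\in D\times E\mid\pi(a)\in[\![\mathrm{Pre}(e)]\!]_\pi\}$ with $(a,e_1)R_{D_{X\otimes E}}(b,e_2)$ iff $aR_Db$ and $e_1R_Ee_2$, and $\pi_{X\otimes E}(a,e)=(\pi(a),e)$; its $n$-fold fibered product over $X\otimes E$ is identified with $D^n_{X\otimes E}=\{(\bar a,e)\in D^n_X\times E\mid\pi^n(\bar a)\in[\![\mathrm{Pre}(e)]\!]_\pi\}$ with $(\bar a,e_1)R(\bar b,e_2)$ iff $a_iR_Db_i$ for all $i$ and $e_1R_Ee_2$; $[\![f]\!]_{\pi_{X\otimes E}}(\bar a,e)=([\![f]\!]_\pi(\bar a),e)$ and $[\![F]\!]_{\pi_{X\otimes E}}=\{(\bar a,e)\in D^n_{X\otimes E}\mid\bar a\in[\![F]\!]_\pi\}$. -}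

module Defs where

open import Level using (Level; _⊔_; suc)
open import Data.Nat using (ℕ)
open import Data.Fin using (Fin)
open import Data.Product using (Σ; Σ-syntax; _×_; _,_; proj₁; proj₂)
open import Relation.Binary.PropositionalEquality using (_≡_; refl; sym; trans; cong; subst)

record Frame : Set₁ where
  field
    Carrier : Set
    R       : Carrier → Carrier → Set
open Frame public

Monotone : (F G : Frame) → (Carrier F → Carrier G) → Set
Monotone F G f = ∀ {w v} → R F w v → R G (f w) (f v)

IsBoundedMorphism : (F G : Frame) → (Carrier F → Carrier G) → Set
IsBoundedMorphism F G f =
  Monotone F G f ×
  (∀ (w : Carrier F) (v' : Carrier G) → R G (f w) v' →
     Σ[ v ∈ Carrier F ] (R F w v × f v ≡ v'))

IsKripkeSheaf : (D X : Frame) → (Carrier D → Carrier X) → Set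
IsKripkeSheaf D X π =
  IsBoundedMorphism D X π ×
  (∀ (a b b' : Carrier D) → R D a b → R D a b' → π b ≡ π b' → b ≡ b')

-- n-fold fibered product D^n_X of π : D → X over X:
-- a point x of X together with an n-tuple of elements of D all lying over x.
-- (For n = 0 this is (isomorphic to) X, for n = 1 to D.)
FibCarrier : (D X : Frame) → (Carrier D → Carrier X) → ℕ → Set
FibCarrier D X π n = Σ[ x ∈ Carrier X ] Σ[ a ∈ (Fin n → Carrier D) ] (∀ i → π (a i) ≡ x)

FibFrame : (D X : Frame) → (Carrier D → Carrier X) → ℕ → Frame
FibFrame D X π n = record
  { Carrier = FibCarrier D X π n
  ; R = λ u v → R X (proj₁ u) (proj₁ v) × (∀ i → R D (proj₁ (proj₂ u) i) (proj₁ (proj₂ v) i)) }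

πⁿ : (D X : Frame) (π : Carrier D → Carrier X) (n : ℕ) → FibCarrier D X π n → Carrier X
πⁿ D X π n = proj₁

IsMonotoneOver : (D X : Frame) (π : Carrier D → Carrier X) (n : ℕ) →
                 (FibCarrier D X π n → Carrier D) → Set
IsMonotoneOver D X π n g =
  Monotone (FibFrame D X π n) D g × (∀ u → π (g u) ≡ πⁿ D X π n u)

record Signature : Set₁ where
  field
    FunSym  : Set
    funAr   : FunSym → ℕ
    RelSym  : Set
    relAr   : RelSym → ℕ
open Signature public

record KSModel (Sig : Signature) : Set₁ where
  field
    X  : Frame
    D  : Frame
    π  : Carrier D → Carrier X
    isSheaf : IsKripkeSheaf D X π
    funI    : (f : FunSym Sig) → FibCarrier D X π (funAr Sig f) → Carrier D
    funI-mono : (f : FunSym Sig) → IsMonotoneOver D X π (funAr Sig f) (funI f)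
    relI    : (F : RelSym Sig) → FibCarrier D X π (relAr Sig F) → Set
open KSModel public

-- event model with preconditions: for each event e, the interpretation
-- [[Pre(e)]]_π ⊆ X of its closed precondition sentence, given as a
-- proposition-valued predicate on X.
record EventModel (M : Frame) : Set₁ where
  field
    Ev      : Frame
    Pre     : Carrier Ev → Carrier M → Set
    Pre-prop : ∀ e w (p q : Pre e w) → p ≡ q
open EventModel public

module PullbackUpdate {Sig : Signature} (M : KSModel Sig) (EM : EventModel (X M)) where
  private
    E = Ev EM

  XE : Frame
  XE = record
    { Carrier = Σ[ we ∈ Carrier (X M) × Carrier E ] Pre EM (proj₂ we) (proj₁ we)
    ; R = λ u v → R (X M) (proj₁ (proj₁ u)) (proj₁ (proj₁ v)) × R E (proj₂ (proj₁ u)) (proj₂ (proj₁ v)) }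

  pX : Carrier XE → Carrier (X M)
  pX u = proj₁ (proj₁ u)

  DE : Frame
  DE = record
    { Carrier = Σ[ ae ∈ Carrier (D M) × Carrier E ] Pre EM (proj₂ ae) (π M (proj₁ ae))
    ; R = λ u v → R (D M) (proj₁ (proj₁ u)) (proj₁ (proj₁ v)) × R E (proj₂ (proj₁ u)) (proj₂ (proj₁ v)) }

  πE : Carrier DE → Carrier XE
  πE ((a , e) , p) = (π M a , e) , p

  -- updated interpretation of an n-ary function symbol:
  -- [[f]]((a₁,e),…,(aₙ,e)) = ([[f]](a₁,…,aₙ) , e), on the n-fold fibered
  -- product of D_{X⊗E} over X ⊗ E.
  funIE : (f : FunSym Sig) → FibCarrier DE XE πE (funAr Sig f) → Carrier DE
  funIE f (((w , e) , q) , a' , eqs) =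
    (funI M f (w , (λ i → proj₁ (proj₁ (a' i))) , (λ i → cong (λ u → proj₁ (proj₁ u)) (eqs i))) , e)
    , subst (Pre EM e)
        (sym (proj₂ (funI-mono M f) (w , (λ i → proj₁ (proj₁ (a' i))) , (λ i → cong (λ u → proj₁ (proj₁ u)) (eqs i)))))
        q

  relIE : (F : RelSym Sig) → FibCarrier DE XE πE (relAr Sig F) → Set
  relIE F (((w , e) , q) , a' , eqs) =
    relI M F (w , (λ i → proj₁ (proj₁ (a' i))) , (λ i → cong (λ u → proj₁ (proj₁ u)) (eqs i)))

module Submission where

-- Both X ⊗ E and D_{X⊗E} are instances of one construction: for a frame F,
-- a frame E of events and a proposition-valued precondition P on E × F, the
-- update F ⊗_P E is the subframe of the product F × E cut out by P.  A map
-- π : D → X induces π ⊗ E : D ⊗_{P∘π} E → X ⊗_P E, (a , e) ↦ (π a , e).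
-- We first show, for arbitrary frames, that π ⊗ E inherits monotonicity,
-- the back condition and uniqueness of lifts from π (the last one because
-- preconditions are propositions), so that π ⊗ E is a Kripke sheaf whenever
-- π is.  Second, for the updated interpretation of a function symbol,
-- monotonicity is inherited from [[f]]_π componentwise, and lying over
-- X ⊗ E follows from [[f]]_π lying over X, by transporting the precondition
-- witness.

open import Defs
open import Data.Product using (Σ-syntax; _×_; _,_; proj₁; proj₂)
open import Relation.Binary.PropositionalEquality using (_≡_; refl; sym; cong; subst)

Update : (F E : Frame) → (Carrier E → Carrier F → Set) → Frame
Update F E P = record
  { Carrier = Σ[ we ∈ Carrier F × Carrier E ] P (proj₂ we) (proj₁ we)
  ; R = λ u v → R F (proj₁ (proj₁ u)) (proj₁ (proj₁ v)) × R E (proj₂ (proj₁ u)) (proj₂ (proj₁ v)) }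

module UpdateOfMap (D X E : Frame) (π : Carrier D → Carrier X) (P : Carrier E → Carrier X → Set) where

  P∘π : Carrier E → Carrier D → Set
  P∘π e a = P e (π a)

  π⊗E : Carrier (Update D E P∘π) → Carrier (Update X E P)
  π⊗E ((a , e) , p) = (π a , e) , p

  π⊗E-monotone : Monotone D X π → Monotone (Update D E P∘π) (Update X E P) π⊗E
  π⊗E-monotone π-mono (r , s) = π-mono r , s

  -- Back condition: a successor (x' , e') of (π a , e) lifts along π to a
  -- successor b of a with π b ≡ x', and (b , e') keeps the precondition witness.
  π⊗E-back :
    (∀ (a : Carrier D) (x' : Carrier X) → R X (π a) x' → Σ[ b ∈ Carrier D ] (R D a b × π b ≡ x')) →
    ∀ (u : Carrier (Update D E P∘π)) (v' : Carrier (Update X E P)) → R (Update X E P) (π⊗E u) v' →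
    Σ[ v ∈ Carrier (Update D E P∘π) ] (R (Update D E P∘π) u v × π⊗E v ≡ v')
  π⊗E-back π-back ((a , e) , _) ((x' , e') , q) (r , s) with π-back a x' r
  ... | b , r' , refl = ((b , e') , q) , (r' , s) , refl

  -- Uniqueness of lifts: equal images force equal D- and event components
  -- (uniqueness for π), and then equal precondition witnesses (P is a proposition).
  π⊗E-unique :
    (∀ e x (p q : P e x) → p ≡ q) →
    (∀ (a b b' : Carrier D) → R D a b → R D a b' → π b ≡ π b' → b ≡ b') →
    ∀ (u v v' : Carrier (Update D E P∘π)) →
    R (Update D E P∘π) u v → R (Update D E P∘π) u v' → π⊗E v ≡ π⊗E v' → v ≡ v'
  π⊗E-unique P-prop π-unique ((a , _) , _) ((b , e) , q) ((b' , e') , q') (r , _) (r' , _) eq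
    with π-unique a b b' r r' (cong (λ w → proj₁ (proj₁ w)) eq) | cong (λ w → proj₂ (proj₁ w)) eq
  ... | refl | refl = cong (λ z → (b , e) , z) (P-prop e (π b) q q')

  π⊗E-sheaf : (∀ e x (p q : P e x) → p ≡ q) →
    IsKripkeSheaf D X π → IsKripkeSheaf (Update D E P∘π) (Update X E P) π⊗E
  π⊗E-sheaf P-prop ((π-mono , π-back) , π-unique) =
    ((λ {u} {v} → π⊗E-monotone π-mono {u} {v}) , π⊗E-back π-back) , π⊗E-unique P-prop π-unique

transport-witness : ∀ {A E : Set} (P : E → A → Set) {x w : A} (e : E) (h : x ≡ w) (q : P e w) →
  _≡_ {A = Σ[ ae ∈ A × E ] P (proj₂ ae) (proj₁ ae)}
    ((x , e) , subst (P e) (sym h) q) ((w , e) , q)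
transport-witness P e refl q = refl

module UpdatedInterpretation {Sig : Signature} (M : KSModel Sig) (EM : EventModel (X M)) where
  open PullbackUpdate M EM

  -- [[f]]_{π_{X⊗E}} is monotone over X ⊗ E: monotone because [[f]]_π is, and
  -- over X ⊗ E because [[f]]_π lies over X (transporting the witness of Pre(e)).
  funIE-monotone-over : (f : FunSym Sig) → IsMonotoneOver DE XE πE (funAr Sig f) (funIE f)
  funIE-monotone-over f = monotone , over
    where
    monotone : Monotone (FibFrame DE XE πE (funAr Sig f)) DE (funIE f)
    monotone ((r , s) , rs) = proj₁ (funI-mono M f) (r , λ i → proj₁ (rs i)) , s

    over : ∀ u → πE (funIE f u) ≡ πⁿ DE XE πE (funAr Sig f) u
    over (((w , e) , q) , a , eqs) =
      transport-witness (Pre EM) e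
        (proj₂ (funI-mono M f) (w , (λ i → proj₁ (proj₁ (a i))) , (λ i → cong (λ u → proj₁ (proj₁ u)) (eqs i))))
        q

theorem4p5 : {Sig : Signature} (M : KSModel Sig) (EM : EventModel (X M)) →
    IsKripkeSheaf (PullbackUpdate.DE M EM) (PullbackUpdate.XE M EM) (PullbackUpdate.πE M EM)
    × ((f : FunSym Sig) →
         IsMonotoneOver (PullbackUpdate.DE M EM) (PullbackUpdate.XE M EM) (PullbackUpdate.πE M EM)
           (funAr Sig f) (PullbackUpdate.funIE M EM f))
theorem4p5 M EM =
  UpdateOfMap.π⊗E-sheaf (D M) (X M) (Ev EM) (π M) (Pre EM) (Pre-prop EM) (isSheaf M) ,
  UpdatedInterpretation.funIE-monotone-over M EM
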